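{- Let $n\ge 2$ be an integer, let $(U_r)_{r\in\mathbb{Z}}$ be the $n$-step Fibonacci numbers and let $(W_r)_{r\in\mathbb{Z}}$ be any generalized $n$-step Fibonacci sequence. Then for all integers $r$ and $s$, \[ W_{r+s}=\sum_{i=1}^{n}\left(\sum_{j=0}^{n-i}U_{s-j+1}\right)W_{r-i}. \]
   Context: For an integer $n\ge 2$, the $n$-step Fibonacci numbers $(U_r)_{r\in\mathbb{Z}}$ are the unique two-sided sequence satisfying $U_r=\sum_{i=1}^{n}U_{r-i}$ for all $r\in\mathbb{Z}$, with $U_k=0$ for $-n+2\le k\le 0$ and $U_{ -n+1}=1$. A generalized $n$-step Fibonacci sequence is any sequence $(W_r)_{r\in\mathbb{Z}}$ of complex numbers satisfying $W_r=\sum_{i=1}^{n}W_{r-i}$ for all $r\in\mathbb{Z}$ (its values $W_0,\dots,W_{n-1}$ are arbitrary; the recurrence determines it uniquely in both directions). -}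

module Defs where

open import Level using (Level)
open import Data.Nat using (ℕ; zero; suc; _≤_; _∸_)
open import Data.Integer using (ℤ; +_; _-_; -_)
open import Algebra.Bundles using (CommutativeRing)

sumR : ∀ {c ℓ} (R : CommutativeRing c ℓ) → ℕ → (ℕ → CommutativeRing.Carrier R) → CommutativeRing.Carrier R
sumR R zero    f = CommutativeRing.0# R
sumR R (suc k) f = CommutativeRing._+_ R (sumR R k f) (f k)

IsNStep : ∀ {c ℓ} (R : CommutativeRing c ℓ) → ℕ → (ℤ → CommutativeRing.Carrier R) → Set ℓ
IsNStep R n W = ∀ (r : ℤ) → CommutativeRing._≈_ R (W r) (sumR R n (λ k → W (r - + (suc k))))

-- U is the n-step Fibonacci sequence: satisfies the recurrence, U k = 0 for -n+2 ≤ k ≤ 0,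
-- and U (-n+1) = 1.  (Such a U is unique.)
IsNStepFibonacci : ∀ {c ℓ} (R : CommutativeRing c ℓ) → ℕ → (ℤ → CommutativeRing.Carrier R) → Set ℓ
IsNStepFibonacci R n U =
  IsNStep R n U
  × (∀ (m : ℕ) → m ≤ n ∸ 2 → CommutativeRing._≈_ R (U (- (+ m))) (CommutativeRing.0# R))
  × CommutativeRing._≈_ R (U (- (+ (n ∸ 1)))) (CommutativeRing.1# R)
  where open import Data.Product using (_×_)

-- Write Fₛ(r) for the right-hand side.  Each coefficient of Fₛ₊₁ is U (s + 2) plus the
-- next coefficient of Fₛ (the last one has no successor), and U (s + 2) is the first
-- coefficient of Fₛ by the recurrence of U.  Collecting the U (s + 2) terms into W r by the
-- recurrence of W gives Fₛ₊₁(r) = Fₛ(r + 1).  The initial values of U make every coefficient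
-- of F₀ equal to U 1 = 1, so F₀(r) = W r, and induction on s in both directions finishes.
{-# OPTIONS --safe #-}
module Submission where

open import Defs
open import Data.Nat using (ℕ; zero; suc; _≤_; _<_; _∸_)
import Data.Nat.Properties as ℕ
open import Data.Integer using (ℤ; +_; -[1+_]; _+_; _-_; -_)
open import Data.Integer.Tactic.RingSolver using (solve-∀)
import Data.Integer.Properties as ℤ
open import Data.Product using (proj₁; proj₂)
open import Algebra.Bundles using (CommutativeRing)
open import Relation.Binary.PropositionalEquality using (_≡_; cong; subst)

i+1+1-[1+j]≡i-j+1 : ∀ i j → i + + 1 + + 1 - (+ 1 + j) ≡ i - j + + 1
i+1+1-[1+j]≡i-j+1 = solve-∀

i+1-0+1≡i+1+1 : ∀ i → i + + 1 - + 0 + + 1 ≡ i + + 1 + + 1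
i+1-0+1≡i+1+1 = solve-∀

i+1-[1+j]+1≡i-j+1 : ∀ i j → i + + 1 - (+ 1 + j) + + 1 ≡ i - j + + 1
i+1-[1+j]+1≡i-j+1 = solve-∀

i≡i+1-1 : ∀ i → i ≡ i + + 1 - + 1
i≡i+1-1 = solve-∀

i-[1+j]≡i+1-[2+j] : ∀ i j → i - (+ 1 + j) ≡ i + + 1 - (+ 2 + j)
i-[1+j]≡i+1-[2+j] = solve-∀

i+1+j≡i+[j+1] : ∀ i j → i + + 1 + j ≡ i + (j + + 1)
i+1+j≡i+[j+1] = solve-∀

i≡i-1+1 : ∀ i → i ≡ i - + 1 + + 1
i≡i-1+1 = solve-∀

i-1+[j+1]≡i+j : ∀ i j → i - + 1 + (j + + 1) ≡ i + j
i-1+[j+1]≡i+j = solve-∀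

1-[1+j]≡-j : ∀ j → + 1 - (+ 1 + j) ≡ - j
1-[1+j]≡-j = solve-∀

0-[1+j]+1≡-j : ∀ j → + 0 - (+ 1 + j) + + 1 ≡ - j
0-[1+j]+1≡-j = solve-∀

ℤ-induction : ∀ {p} (P : ℤ → Set p) → P (+ 0) →
              (∀ s → P s → P (s + + 1)) → (∀ s → P (s + + 1) → P s) → ∀ s → P s
ℤ-induction P base up down (+ k)      = nonNegative k
  where
  nonNegative : ∀ k → P (+ k)
  nonNegative zero    = base
  nonNegative (suc k) = subst P (cong +_ (ℕ.+-comm k 1)) (up (+ k) (nonNegative k))
ℤ-induction P base up down -[1+ k ]   = negative k
  where
  negative : ∀ k → P -[1+ k ]
  negative zero    = down -[1+ 0 ] base
  negative (suc k) = down -[1+ suc k ] (negative k)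

module FiniteSums {c ℓ} (R : CommutativeRing c ℓ) where
  open CommutativeRing R renaming (_+_ to _⊕_; _*_ to _⊗_)
  open import Algebra.Properties.CommutativeSemigroup +-commutativeSemigroup using (interchange)

  sumR-cong : ∀ q {f g : ℕ → Carrier} → (∀ j → j < q → f j ≈ g j) → sumR R q f ≈ sumR R q g
  sumR-cong zero    f≈g = refl
  sumR-cong (suc q) f≈g = +-cong (sumR-cong q (λ j j<q → f≈g j (ℕ.m≤n⇒m≤1+n j<q))) (f≈g q ℕ.≤-refl)

  sumR-zero : ∀ q {f : ℕ → Carrier} → (∀ j → j < q → f j ≈ 0#) → sumR R q f ≈ 0#
  sumR-zero q f≈0 = trans (sumR-cong q f≈0) (sumR-const-0 q)
    where
    sumR-const-0 : ∀ q → sumR R q (λ _ → 0#) ≈ 0#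
    sumR-const-0 zero    = refl
    sumR-const-0 (suc q) = trans (+-identityʳ _) (sumR-const-0 q)

  sumR-distrib-+ : ∀ q (f g : ℕ → Carrier) → sumR R q (λ j → f j ⊕ g j) ≈ sumR R q f ⊕ sumR R q g
  sumR-distrib-+ zero    f g = sym (+-identityʳ 0#)
  sumR-distrib-+ (suc q) f g = trans (+-congʳ (sumR-distrib-+ q f g)) (interchange _ _ _ _)

  *-distribˡ-sumR : ∀ q x (f : ℕ → Carrier) → x ⊗ sumR R q f ≈ sumR R q (λ j → x ⊗ f j)
  *-distribˡ-sumR zero    x f = zeroʳ x
  *-distribˡ-sumR (suc q) x f = trans (distribˡ x _ _) (+-congʳ (*-distribˡ-sumR q x f))

  sumR-suc-head : ∀ q (f : ℕ → Carrier) → sumR R (suc q) f ≈ f 0 ⊕ sumR R q (λ j → f (suc j))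
  sumR-suc-head zero    f = trans (+-identityˡ (f 0)) (sym (+-identityʳ (f 0)))
  sumR-suc-head (suc q) f = trans (+-congʳ (sumR-suc-head q f)) (+-assoc _ _ _)

module NStep {c ℓ} (R : CommutativeRing c ℓ) (m : ℕ) where
  open CommutativeRing R renaming (_+_ to _⊕_; _*_ to _⊗_) hiding (_-_; -_)
  open import Relation.Binary.Reasoning.Setoid setoid
  open FiniteSums R

  n : ℕ
  n = suc m

  ≈-cong : (f : ℤ → Carrier) → ∀ {i j} → i ≡ j → f i ≈ f j
  ≈-cong f i≡j = reflexive (cong f i≡j)

  descendingSum : (ℤ → Carrier) → ℤ → ℕ → Carrier
  descendingSum U s q = sumR R q (λ j → U (s - + j + + 1))

  coefficient : (ℤ → Carrier) → ℤ → ℕ → Carrier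
  coefficient U s k = descendingSum U s (suc (n ∸ suc k))

  combination : (U W : ℤ → Carrier) → ℤ → ℤ → Carrier
  combination U W r s = sumR R n (λ k → coefficient U s k ⊗ W (r - + suc k))

  Expansion : (U W : ℤ → Carrier) → ℤ → Set ℓ
  Expansion U W s = ∀ r → combination U W r s ≈ W (r + s)

  sumR-descendingSum-tails : ∀ U s (f : ℕ → Carrier) →
    sumR R n (λ k → descendingSum U s (m ∸ k) ⊗ f k) ≈ sumR R m (λ k → coefficient U s (suc k) ⊗ f k)
  sumR-descendingSum-tails U s f = begin
    sumR R m (λ k → descendingSum U s (m ∸ k) ⊗ f k) ⊕ descendingSum U s (m ∸ m) ⊗ f m
      ≈⟨ +-cong (sumR-cong m λ k k<m → *-congʳ (tail<m k k<m)) (trans (*-congʳ tail-m) (zeroˡ (f m))) ⟩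
    sumR R m (λ k → coefficient U s (suc k) ⊗ f k) ⊕ 0#
      ≈⟨ +-identityʳ _ ⟩
    sumR R m (λ k → coefficient U s (suc k) ⊗ f k) ∎
    where
    tail<m : ∀ k → k < m → descendingSum U s (m ∸ k) ≈ coefficient U s (suc k)
    tail<m k k<m rewrite ℕ.+-∸-assoc 1 k<m = refl
    tail-m : descendingSum U s (m ∸ m) ≈ 0#
    tail-m rewrite ℕ.n∸n≡0 m = refl

  module _ {U : ℤ → Carrier} (U-rec : IsNStep R n U) where

    coefficient-head : ∀ s → U (s + + 1 + + 1) ≈ coefficient U s 0
    coefficient-head s = trans (U-rec _) (sumR-cong n λ k _ → ≈-cong U (i+1+1-[1+j]≡i-j+1 s (+ k)))

    descendingSum-suc : ∀ s q →
      descendingSum U (s + + 1) (suc q) ≈ coefficient U s 0 ⊕ descendingSum U s q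
    descendingSum-suc s q = trans (sumR-suc-head q _)
      (+-cong (trans (≈-cong U (i+1-0+1≡i+1+1 s)) (coefficient-head s))
              (sumR-cong q λ j _ → ≈-cong U (i+1-[1+j]+1≡i-j+1 s (+ j))))

    module _ {W : ℤ → Carrier} (W-rec : IsNStep R n W) where

      combination-shift : ∀ r s → combination U W r (s + + 1) ≈ combination U W (r + + 1) s
      combination-shift r s = begin
        sumR R n (λ k → coefficient U (s + + 1) k ⊗ w k)
          ≈⟨ sumR-cong n (λ k _ → trans (*-congʳ (descendingSum-suc s (m ∸ k))) (distribʳ _ _ _)) ⟩
        sumR R n (λ k → γ 0 ⊗ w k ⊕ descendingSum U s (m ∸ k) ⊗ w k)
          ≈⟨ sumR-distrib-+ n _ _ ⟩
        sumR R n (λ k → γ 0 ⊗ w k) ⊕ sumR R n (λ k → descendingSum U s (m ∸ k) ⊗ w k)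
          ≈⟨ +-cong (sym (*-distribˡ-sumR n (γ 0) w)) (sumR-descendingSum-tails U s w) ⟩
        γ 0 ⊗ sumR R n w ⊕ sumR R m (λ k → γ (suc k) ⊗ w k)
          ≈⟨ +-cong (*-congˡ (trans (sym (W-rec r)) (≈-cong W (i≡i+1-1 r))))
                    (sumR-cong m λ k _ → *-congˡ (≈-cong W (i-[1+j]≡i+1-[2+j] r (+ k)))) ⟩
        γ 0 ⊗ W (r + + 1 - + 1) ⊕ sumR R m (λ k → γ (suc k) ⊗ W (r + + 1 - + suc (suc k)))
          ≈⟨ sym (sumR-suc-head m _) ⟩
        combination U W (r + + 1) s ∎
        where
        γ w : ℕ → Carrier
        γ = coefficient U s
        w k = W (r - + suc k)

      Expansion-suc : ∀ s → Expansion U W s → Expansion U W (s + + 1)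
      Expansion-suc s expansion r = begin
        combination U W r (s + + 1)   ≈⟨ combination-shift r s ⟩
        combination U W (r + + 1) s   ≈⟨ expansion (r + + 1) ⟩
        W (r + + 1 + s)               ≈⟨ ≈-cong W (i+1+j≡i+[j+1] r s) ⟩
        W (r + (s + + 1))             ∎

      Expansion-pred : ∀ s → Expansion U W (s + + 1) → Expansion U W s
      Expansion-pred s expansion r = begin
        combination U W r s                   ≈⟨ ≈-cong (λ i → combination U W i s) (i≡i-1+1 r) ⟩
        combination U W (r - + 1 + + 1) s     ≈⟨ sym (combination-shift (r - + 1) s) ⟩
        combination U W (r - + 1) (s + + 1)   ≈⟨ expansion (r - + 1) ⟩
        W (r - + 1 + (s + + 1))               ≈⟨ ≈-cong W (i-1+[j+1]≡i+j r s) ⟩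
        W (r + s)                             ∎

  module _ {U : ℤ → Carrier} (U-fib : IsNStepFibonacci R n U) where

    U-rec : IsNStep R n U
    U-rec = proj₁ U-fib

    U-initial-0 : ∀ j → j < m → U (- + j) ≈ 0#
    U-initial-0 j j<m = proj₁ (proj₂ U-fib) j (ℕ.∸-monoˡ-≤ 1 j<m)

    U-1≈1 : U (+ 1) ≈ 1#
    U-1≈1 = begin
      U (+ 1)                                               ≈⟨ U-rec (+ 1) ⟩
      sumR R m (λ k → U (+ 1 - + suc k)) ⊕ U (+ 1 - + n)    ≈⟨ +-cong
        (sumR-zero m λ j j<m → trans (≈-cong U (1-[1+j]≡-j (+ j))) (U-initial-0 j j<m))
        (trans (≈-cong U (1-[1+j]≡-j (+ m))) (proj₂ (proj₂ U-fib))) ⟩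
      0# ⊕ 1#                                               ≈⟨ +-identityˡ 1# ⟩
      1#                                                    ∎

    coefficient-0 : ∀ k → coefficient U (+ 0) k ≈ 1#
    coefficient-0 k = begin
      coefficient U (+ 0) k                                  ≈⟨ sumR-suc-head (m ∸ k) _ ⟩
      U (+ 1) ⊕ sumR R (m ∸ k) (λ j → U (+ 0 - + suc j + + 1))
        ≈⟨ +-cong U-1≈1 (sumR-zero (m ∸ k) λ j j<m∸k →
             trans (≈-cong U (0-[1+j]+1≡-j (+ j))) (U-initial-0 j (ℕ.≤-trans j<m∸k (ℕ.m∸n≤m m k)))) ⟩
      1# ⊕ 0#                                                ≈⟨ +-identityʳ 1# ⟩
      1#                                                     ∎

    Expansion-0 : ∀ {W} → IsNStep R n W → Expansion U W (+ 0)
    Expansion-0 {W} W-rec r = begin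
      combination U W r (+ 0)            ≈⟨ sumR-cong n (λ k _ → trans (*-congʳ (coefficient-0 k)) (*-identityˡ _)) ⟩
      sumR R n (λ k → W (r - + suc k))   ≈⟨ sym (W-rec r) ⟩
      W r                                ≈⟨ sym (≈-cong W (ℤ.+-identityʳ r)) ⟩
      W (r + + 0)                        ∎

theorem1 : ∀ {c ℓ} (R : CommutativeRing c ℓ) (n : ℕ) → 2 ≤ n →
    (U W : ℤ → CommutativeRing.Carrier R) →
    IsNStepFibonacci R n U → IsNStep R n W →
    ∀ (r s : ℤ) →
    CommutativeRing._≈_ R (W (r + s))
    (sumR R n (λ k → CommutativeRing._*_ R
    (sumR R (suc (n ∸ suc k)) (λ j → U (s - + j + + 1)))
    (W (r - + (suc k)))))
theorem1 R (suc m) _ U W U-fib W-rec r s =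
  CommutativeRing.sym R (ℤ-induction (Expansion U W)
    (Expansion-0 U-fib W-rec)
    (Expansion-suc (U-rec U-fib) W-rec)
    (Expansion-pred (U-rec U-fib) W-rec)
    s r)
  where open NStep R m
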